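{- Let $G$ be a graph and $H$ a subgraph of $G$ that is a retract of $G$, i.e. there is a homomorphism $f$ from $G$ to $H$ with $f(x)=x$ for all $x \in V(H)$. Then for every positive integer $k$, $\gamma_{all,k}^\infty(H) \leq \gamma_{all,k}^\infty(G)$.
   Context: A homomorphism $f$ from $G$ to $H$ is a map $V(G)\to V(H)$ sending adjacent vertices of $G$ to adjacent vertices of $H$. Graphs are finite and simple; $d(u,v)$ is graph distance and $N_k[x]=\{v: d(x,v)\le k\}$. A multiset $D$ of vertices of $G$ is a distance-$k$ dominating set if every vertex of $V(G)\setminus D$ is at distance at most $k$ from some element of $D$. Let $\mathbb{D}_{k,q}(G)$ be the set of such multisets of cardinality $q$. $D=\{v_1,\dots,v_q\}$ transforms to $D'=\{u_1,\dots,u_q\}$ if (for some indexing) $u_i\in N_k[v_i]$ for all $i$. An eternal distance-$k$ dominating family is $\mathcal{E}\subseteq\mathbb{D}_{k,q}(G)$ for some $q$ such that for every $D\in\mathcal{E}$ and every vertex $v$ there is $D'\in\mathcal{E}$ with $v\in D'$ and $D$ transforms to $D'$. $\gamma_{all,k}^\infty(G)$ is the minimum $q$ for which such a family exists. -}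

module Defs where

open import Data.Nat using (ℕ; zero; suc)
open import Data.Fin using (Fin)
open import Data.Fin.Permutation using (Permutation′; _⟨$⟩ʳ_)
open import Data.Product using (Σ; ∃; _×_; _,_)
open import Data.Sum using (_⊎_)
open import Relation.Nullary using (¬_)
open import Relation.Binary.PropositionalEquality using (_≡_)

record Graph : Set₁ where
  field
    n      : ℕ
    Adj    : Fin n → Fin n → Set
    sym    : ∀ {u v} → Adj u v → Adj v u
    irrefl : ∀ {u} → ¬ Adj u u

module _ (G : Graph) where
  open Graph G

  V : Set
  V = Fin n

  -- Within k u v  ⇔  d(u,v) ≤ k  (there is a walk of length ≤ k from u to v)
  data Within : ℕ → V → V → Set where
    here : ∀ {k u} → Within k u u
    step : ∀ {k u w v} → Adj u w → Within k w v → Within (suc k) u v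

  -- A multiset of q vertices, represented by an indexed family (order irrelevant).
  MSet : ℕ → Set
  MSet q = Fin q → V

  IsDistDom : (k q : ℕ) → MSet q → Set
  IsDistDom k q D = ∀ v → (∃ λ i → D i ≡ v) ⊎ (∃ λ i → Within k (D i) v)

  Transforms : (k q : ℕ) → MSet q → MSet q → Set
  Transforms k q D D' = Σ (Permutation′ q) λ σ → ∀ i → Within k (D i) (D' (σ ⟨$⟩ʳ i))

  IsEternalFamily : (k q : ℕ) → (MSet q → Set) → Set
  IsEternalFamily k q E =
    (∀ D → E D → IsDistDom k q D) ×
    (∀ D → E D → ∀ v → Σ (MSet q) λ D' → E D' × Transforms k q D D' × (∃ λ i → D' i ≡ v))

  HasEternalFamily : (k q : ℕ) → Set₁
  HasEternalFamily k q = Σ (MSet q → Set) λ E → IsEternalFamily k q E × Σ (MSet q) E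

record Retract (H G : Graph) : Set where
  field
    ι       : V H → V G
    ι-inj   : ∀ {x y} → ι x ≡ ι y → x ≡ y
    ι-edge  : ∀ {x y} → Graph.Adj H x y → Graph.Adj G (ι x) (ι y)
    f       : V G → V H
    f-hom   : ∀ {u v} → Graph.Adj G u v → Graph.Adj H (f u) (f v)
    f-retr  : ∀ x → f (ι x) ≡ x

-- Push everything forward along the retraction f.  A homomorphism never
-- increases distances, so f maps moves of guards in G to moves in H.  Since f
-- fixes H, a vertex v of H that is dominated (resp. occupied) in G as the vertex
-- ι v is dominated (resp. occupied) by the image multiset in H.  So the image of
-- an eternal family of G is an eternal family of H of the same size.
module Submission where

open import Defs
open import Data.Nat using (ℕ; _≤_)
open import Data.Nat.Properties using (≤-refl)
open import Data.Product using (Σ; ∃; _×_; _,_)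
open import Data.Sum using (inj₁; inj₂)
open import Function using (_∘_)
open import Relation.Binary.PropositionalEquality
  using (_≡_; _≗_; refl; sym; trans; cong; subst)

module _ {G H : Graph} (h : V G → V H)
         (h-hom : ∀ {u v} → Graph.Adj G u v → Graph.Adj H (h u) (h v)) where

  Within-map : ∀ {k u v} → Within G k u v → Within H k (h u) (h v)
  Within-map here       = here
  Within-map (step a w) = step (h-hom a) (Within-map w)

  Transforms-map : ∀ {k q D D′} → Transforms G k q D D′ →
                   Transforms H k q (h ∘ D) (h ∘ D′)
  Transforms-map (σ , moves) = σ , Within-map ∘ moves

module _ {G : Graph} {k q : ℕ} {D₁ D₂ : MSet G q} (D₁≗D₂ : D₁ ≗ D₂) where

  IsDistDom-resp-≗ : IsDistDom G k q D₁ → IsDistDom G k q D₂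
  IsDistDom-resp-≗ dom v with dom v
  ... | inj₁ (i , Di≡v) = inj₁ (i , trans (sym (D₁≗D₂ i)) Di≡v)
  ... | inj₂ (i , w)    = inj₂ (i , subst (λ x → Within G k x v) (D₁≗D₂ i) w)

  Transforms-respˡ-≗ : ∀ {D′} → Transforms G k q D₁ D′ → Transforms G k q D₂ D′
  Transforms-respˡ-≗ (σ , moves) =
    σ , λ i → subst (λ x → Within G k x _) (D₁≗D₂ i) (moves i)

module _ {G H : Graph} (R : Retract H G) where
  open Retract R

  occupies-retract : ∀ {q} {D : MSet G q} {v} → ∃ (λ i → D i ≡ ι v) →
                     ∃ (λ i → f (D i) ≡ v)
  occupies-retract {v = v} (i , Di≡ιv) = i , trans (cong f Di≡ιv) (f-retr v)

  IsDistDom-retract : ∀ {k q D} → IsDistDom G k q D → IsDistDom H k q (f ∘ D)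
  IsDistDom-retract {k} {D = D} dom v with dom (ι v)
  ... | inj₁ occupied = inj₁ (occupies-retract occupied)
  ... | inj₂ (i , w)  =
    inj₂ (i , subst (Within H k (f (D i))) (f-retr v) (Within-map f f-hom w))

  image : ∀ {q} → (MSet G q → Set) → MSet H q → Set
  image {q} E D′ = Σ (MSet G q) λ D → E D × (f ∘ D ≗ D′)

  IsEternalFamily-retract : ∀ {k q E} → IsEternalFamily G k q E →
                            IsEternalFamily H k q (image E)
  IsEternalFamily-retract {k} {q} {E} (dom , eternal) = domH , eternalH
    where
    domH : ∀ D′ → image E D′ → IsDistDom H k q D′
    domH D′ (D , D∈E , fD≗D′) = IsDistDom-resp-≗ fD≗D′ (IsDistDom-retract (dom D D∈E))

    eternalH : ∀ D′ → image E D′ → ∀ v →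
               Σ (MSet H q) λ D″ → image E D″ × Transforms H k q D′ D″ × ∃ λ i → D″ i ≡ v
    eternalH D′ (D , D∈E , fD≗D′) v with eternal D D∈E (ι v)
    ... | D₂ , D₂∈E , D↝D₂ , occupied =
      f ∘ D₂ , (D₂ , D₂∈E , λ _ → refl) ,
      Transforms-respˡ-≗ fD≗D′ {f ∘ D₂} (Transforms-map f f-hom {D′ = D₂} D↝D₂) ,
      occupies-retract occupied

  HasEternalFamily-retract : ∀ {k q} → HasEternalFamily G k q → HasEternalFamily H k q
  HasEternalFamily-retract (E , eternal , D , D∈E) =
    image E , IsEternalFamily-retract eternal , f ∘ D , D , D∈E , λ _ → refl

lemma1 : (G H : Graph) → Retract H G → (k : ℕ) → 1 ≤ k →
    (q : ℕ) → HasEternalFamily G k q →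
    Σ ℕ λ q′ → q′ ≤ q × HasEternalFamily H k q′
lemma1 G H R k _ q family = q , ≤-refl , HasEternalFamily-retract R family
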